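{- Let $(\mathbb{D},G)$ be a data symmetry that admits least supports. Let $C,D\subseteq\mathbb{D}$ be finite fungible sets, $S\le G|_C$, $T\le G|_D$, and let $X=X_{C,S}$, $Y=X_{D,T}$. Then equivariant functions $X\to Y$ are in bijective correspondence with the $\equiv_T$-equivalence classes of those injective functions $u:D\to C$ such that $u=\pi|_D$ for some $\pi\in G$ and such that for every $\sigma\in S$ there exists $\tau\in T$ with $\sigma\circ u=u\circ\tau$; here $u\equiv_T v$ iff $v=u\circ\tau$ for some $\tau\in T$.
   Context: A data symmetry is a set $\mathbb{D}$ with a subgroup $G$ of the group of all bijections of $\mathbb{D}$. $(\mathbb{D},G)$ admits least supports if every element of every nominal $G$-set has a least finite support (a $G$-set is nominal if each element $x$ has a finite $C\subseteq\mathbb{D}$ with $x\cdot\pi=x$ for all $\pi\in G$ fixing $C$ pointwise). A finite $C$ is fungible if for each $c\in C$ some $\pi\in G$ moves $c$ and fixes every element of $C\setminus\{c\}$. $G|_C=\{\pi|_C:\pi\in G,\ \pi(C)=C\}$. For finite fungible $C$ and $S\le G|_C$, $X_{C,S}$ is the set of functions $u:C\to\mathbb{D}$ of the form $\pi|_C$ with $\pi\in G$, modulo $u\equiv_S v\iff v=u\circ\sigma$ for some $\sigma\in S$, with $G$-action $[u]\cdot\pi=[\pi\circ u]$. -}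

module Defs where

open import Level using (0ℓ) renaming (suc to lsuc)
open import Data.Nat using (ℕ)
open import Data.Fin using (Fin)
open import Data.List using (List)
open import Data.List.Membership.Propositional using (_∈_)
open import Data.Product using (Σ; ∃; ∃-syntax; _×_; _,_; proj₁; proj₂)
open import Function using (_∘_; id)
open import Function.Bundles using (_↔_; Inverse)
open import Function.Definitions using (Injective)
open import Function.Construct.Composition using (_↔-∘_)
open import Function.Construct.Identity using (↔-id)
open import Function.Construct.Symmetry using (↔-sym)
open import Relation.Binary.Bundles using (Setoid)
open import Relation.Binary.Structures using (IsEquivalence)
open import Relation.Binary.PropositionalEquality
  using (_≡_; _≢_; refl; sym; trans; cong; _≗_)
open import Relation.Nullary using (¬_)

record DataSymmetry : Set₁ where
  field
    𝔻     : Set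
    G     : 𝔻 ↔ 𝔻 → Set
    G-ext : ∀ {π ρ} → Inverse.to π ≗ Inverse.to ρ → G π → G ρ
    G-id  : G (↔-id 𝔻)
    G-∘   : ∀ {π ρ} → G π → G ρ → G (π ↔-∘ ρ)
    G-inv : ∀ {π} → G π → G (↔-sym π)

module _ (DS : DataSymmetry) where
  open DataSymmetry DS

  Gel : Set
  Gel = Σ (𝔻 ↔ 𝔻) G

  app : Gel → 𝔻 → 𝔻
  app π = Inverse.to (proj₁ π)

  idG : Gel
  idG = ↔-id 𝔻 , G-id

  -- composition: app (π ∘G ρ) = app π ∘ app ρ
  _∘G_ : Gel → Gel → Gel
  (π , p) ∘G (ρ , r) = (π ↔-∘ ρ) , G-∘ p r

  -- G-sets (carrier a setoid, right action x · π, with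
  -- (x · π) · ρ = x · (ρ ∘ π), matching [u]·π = [π ∘ u])

  record GSet : Set₁ where
    field
      setoid : Setoid 0ℓ 0ℓ
    open Setoid setoid public
    field
      act      : Carrier → Gel → Carrier
      act-cong : ∀ {x y} {π ρ : Gel} → x ≈ y → app π ≗ app ρ →
                 act x π ≈ act y ρ
      act-id   : ∀ x → act x idG ≈ x
      act-∘    : ∀ x π ρ → act (act x π) ρ ≈ act x (ρ ∘G π)

  FinSubset : Set
  FinSubset = List 𝔻

  Supports : (X : GSet) → FinSubset → GSet.Carrier X → Set
  Supports X C x = ∀ (π : Gel) → (∀ c → c ∈ C → app π c ≡ c) →
                   GSet._≈_ X (GSet.act X x π) x

  IsNominal : GSet → Set
  IsNominal X = ∀ x → ∃[ C ] Supports X C x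

  LeastSupport : (X : GSet) → GSet.Carrier X → FinSubset → Set
  LeastSupport X x C =
    Supports X C x × (∀ C′ → Supports X C′ x → ∀ c → c ∈ C → c ∈ C′)

  AdmitsLeastSupports : Set₁
  AdmitsLeastSupports =
    ∀ (X : GSet) → IsNominal X → ∀ x → ∃[ C ] LeastSupport X x C

  -- Finite subsets C ⊆ 𝔻 used as domains of functions are given by an
  -- injective enumeration Fin n → 𝔻; a function C → A is then a
  -- function Fin n → A.

  record FinSet : Set where
    field
      size  : ℕ
      elem  : Fin size → 𝔻
      elem-inj : Injective _≡_ _≡_ elem
  open FinSet public

  Fungible : FinSet → Set
  Fungible C = ∀ (i : Fin (size C)) → ∃[ π ]
    (app π (elem C i) ≢ elem C i ×
     (∀ j → j ≢ i → app π (elem C j) ≡ elem C j))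

  IsRestriction : (C : FinSet) → (Fin (size C) → 𝔻) → Set
  IsRestriction C u = ∃[ π ] (∀ i → u i ≡ app π (elem C i))

  -- G|_C : σ : C → C such that σ = π|_C for some π ∈ G (with π(C) = C)
  InG∣ : (C : FinSet) → (Fin (size C) → Fin (size C)) → Set
  InG∣ C σ = IsRestriction C (elem C ∘ σ)

  record Subgroup (C : FinSet) : Set₁ where
    field
      P      : (Fin (size C) → Fin (size C)) → Set
      P-ext  : ∀ {σ τ} → σ ≗ τ → P σ → P τ
      P-⊆    : ∀ {σ} → P σ → InG∣ C σ
      P-id   : P id
      P-∘    : ∀ {σ τ} → P σ → P τ → P (σ ∘ τ)
      P-inv  : ∀ {σ} → P σ → ∃[ σ′ ] (P σ′ × (σ ∘ σ′ ≗ id) × (σ′ ∘ σ ≗ id))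

  module XCS (C : FinSet) (S : Subgroup C) where
    open Subgroup S

    Elt : Set
    Elt = Σ (Fin (size C) → 𝔻) (IsRestriction C)

    _≈S_ : Elt → Elt → Set
    (u , _) ≈S (v , _) = ∃[ σ ] (P σ × (∀ i → v i ≡ u (σ i)))

    ≈S-refl : ∀ {x} → x ≈S x
    ≈S-refl = id , P-id , (λ i → refl)

    ≈S-sym : ∀ {x y} → x ≈S y → y ≈S x
    ≈S-sym {u , _} {v , _} (σ , pσ , eq) with P-inv pσ
    ... | σ′ , pσ′ , r , _ =
      σ′ , pσ′ , λ i → trans (cong u (sym (r i))) (sym (eq (σ′ i)))

    ≈S-trans : ∀ {x y z} → x ≈S y → y ≈S z → x ≈S z
    ≈S-trans {u , _} {v , _} {w , _} (σ , pσ , e₁) (τ , pτ , e₂) =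
      σ ∘ τ , P-∘ pσ pτ , λ i → trans (e₂ i) (e₁ (τ i))

    setoid : Setoid 0ℓ 0ℓ
    setoid = record
      { Carrier = Elt
      ; _≈_ = _≈S_
      ; isEquivalence = record
        { refl = λ {x} → ≈S-refl {x}
        ; sym = λ {x} {y} → ≈S-sym {x} {y}
        ; trans = λ {x} {y} {z} → ≈S-trans {x} {y} {z} } }

    act : Elt → Gel → Elt
    act (u , ρ , eq) π = (app π ∘ u) , (π ∘G ρ) , λ i → cong (app π) (eq i)

  X : (C : FinSet) → Subgroup C → GSet
  X C S = record
    { setoid = setoid
    ; act = act
    ; act-cong = λ { {u , _} {v , _} {π} {ρ} (σ , pσ , eq) e →
        σ , pσ , λ i → trans (sym (e (v i))) (cong (app π) (eq i)) }
    ; act-id = λ x → ≈S-refl {x}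
    ; act-∘ = λ x π ρ → ≈S-refl {act (act x π) ρ} }
    where open XCS C S

  record Equivariant (A B : GSet) : Set where
    private
      module A = GSet A
      module B = GSet B
    field
      fun   : A.Carrier → B.Carrier
      cong′ : ∀ {x y} → x A.≈ y → fun x B.≈ fun y
      equiv : ∀ x π → fun (A.act x π) B.≈ B.act (fun x) π

  EquivariantSetoid : GSet → GSet → Setoid 0ℓ 0ℓ
  EquivariantSetoid A B = record
    { Carrier = Equivariant A B
    ; _≈_ = λ f g → ∀ x → Equivariant.fun f x B.≈ Equivariant.fun g x
    ; isEquivalence = record
      { refl = λ x → B.refl
      ; sym = λ e x → B.sym (e x)
      ; trans = λ e₁ e₂ x → B.trans (e₁ x) (e₂ x) } }
    where module B = GSet B

  module Maps (C D : FinSet) (S : Subgroup C) (T : Subgroup D) where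
    module S = Subgroup S
    module T = Subgroup T

    Good : (Fin (size D) → Fin (size C)) → Set
    Good u = Injective _≡_ _≡_ u
           × IsRestriction D (elem C ∘ u)
           × (∀ σ → S.P σ → ∃[ τ ] (T.P τ × (σ ∘ u ≗ u ∘ τ)))

    Elt : Set
    Elt = Σ (Fin (size D) → Fin (size C)) Good

    _≈T_ : Elt → Elt → Set
    (u , _) ≈T (v , _) = ∃[ τ ] (T.P τ × (v ≗ u ∘ τ))

    setoid : Setoid 0ℓ 0ℓ
    setoid = record
      { Carrier = Elt
      ; _≈_ = _≈T_
      ; isEquivalence = record
        { refl = id , T.P-id , (λ i → refl)
        ; sym = λ { {u , _} {v , _} (τ , pτ , eq) → symm u v τ pτ eq }
        ; trans = λ { {u , _} {v , _} {w , _} (τ , pτ , e₁) (τ′ , pτ′ , e₂) →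
            τ ∘ τ′ , T.P-∘ pτ pτ′ , λ i → trans (e₂ i) (e₁ (τ′ i)) } } }
      where
      symm : ∀ u v τ → T.P τ → v ≗ u ∘ τ → ∃[ τ′ ] (T.P τ′ × (u ≗ v ∘ τ′))
      symm u v τ pτ eq with T.P-inv pτ
      ... | τ′ , pτ′ , r , _ =
        τ′ , pτ′ , λ i → trans (cong u (sym (r i))) (sym (eq (τ′ i)))

-- An equivariant f : X_{C,S} → Y is determined by the image [v] of the
-- generic element [id_C], since [w] = [id_C]·π for any π ∈ G extending w.
-- The set v(D) supports [v], and so does C because it supports [id_C].
-- Fungibility of D forces the least support of [v] to be all of v(D): if
-- v(d) were missing, conjugating by ρ (where v = ρ|_D) the element of G that
-- moves only d inside D would give a permutation fixing the least support
-- but moving [v]. Hence v(D) ⊆ C, i.e. v = elem C ∘ u for an injective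
-- u : D → C, and equivariance of f at the stabiliser of [id_C] is exactly
-- the condition relating S and T.
module Submission where

open import Defs

open import Level using (0ℓ)
open import Data.Empty using (⊥-elim)
open import Data.Fin using (Fin; _≟_)
open import Data.List using (List; []; _∷_; tabulate)
open import Data.List.Membership.Propositional using (_∈_)
open import Data.List.Membership.Propositional.Properties
  using (∈-tabulate⁺; ∈-tabulate⁻)
open import Data.List.Relation.Binary.Subset.Propositional using (_⊆_)
open import Data.List.Relation.Unary.Any using (here; there)
open import Data.Product using (∃-syntax; _×_; _,_; proj₁; proj₂)
open import Data.Sum using (_⊎_; inj₁; inj₂)
open import Function using (_∘_; id)
open import Function.Bundles using (Inverse; Injection)
open import Function.Consequences.Setoid
  using (strictlyInverseˡ⇒inverseˡ; strictlyInverseʳ⇒inverseʳ)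
open import Function.Construct.Symmetry using (↔-sym)
open import Function.Definitions using (Injective; Inverseˡ; Inverseʳ)
open import Function.Properties.Inverse using (↔⇒↣)
open import Relation.Binary.Bundles using (Setoid)
open import Relation.Binary.PropositionalEquality
  using (_≡_; _≢_; _≗_; refl; sym; trans; cong; module ≡-Reasoning)
open import Relation.Nullary using (¬_; yes; no)
import Relation.Binary.Reasoning.Setoid as SetoidReasoning

hit-or-avoid : ∀ {A : Set} {n} (v : Fin n → A) (d : Fin n) (L : List A) →
  L ⊆ tabulate v → v d ∈ L ⊎ (∀ {m} → m ∈ L → ∃[ i ] (i ≢ d × m ≡ v i))
hit-or-avoid v d [] _ = inj₂ λ ()
hit-or-avoid v d (x ∷ L) L⊆v with ∈-tabulate⁻ (L⊆v (here refl))
... | i , x≡vi with i ≟ d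
...   | yes refl = inj₁ (here (sym x≡vi))
...   | no i≢d with hit-or-avoid v d L (L⊆v ∘ there)
...     | inj₁ hit   = inj₁ (there hit)
...     | inj₂ avoid = inj₂ λ { (here refl) → i , i≢d , x≡vi
                              ; (there m∈L) → avoid m∈L }

module _ (DS : DataSymmetry) where
  open DataSymmetry DS
  open Equivariant

  app-injective : (π : Gel DS) → Injective _≡_ _≡_ (app DS π)
  app-injective (π , _) = Injection.injective (↔⇒↣ π)

  _⁻¹ : Gel DS → Gel DS
  (π , p) ⁻¹ = ↔-sym π , G-inv p

  conjugate : Gel DS → Gel DS → Gel DS
  conjugate ρ π = _∘G_ DS ρ (_∘G_ DS π (ρ ⁻¹))

  app-conjugate : ∀ ρ π a →
    app DS (conjugate ρ π) (app DS ρ a) ≡ app DS ρ (app DS π a)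
  app-conjugate (ρ , _) π a =
    cong (Inverse.to ρ ∘ app DS π) (Inverse.strictlyInverseʳ ρ a)

  equivariant-supports : ∀ {A B : GSet DS} (f : Equivariant DS A B) {L x} →
    Supports DS A L x → Supports DS B L (fun f x)
  equivariant-supports {A} {B} f {x = x} sup π fixes = begin
      GSet.act B (fun f x) π  ≈⟨ equiv f x π ⟨
      fun f (GSet.act A x π)  ≈⟨ cong′ f (sup π fixes) ⟩
      fun f x                 ∎
    where open SetoidReasoning (GSet.setoid B)

  module _ (C : FinSet DS) (S : Subgroup DS C) where
    open XCS DS C S
    private module S = Subgroup S

    generic : Elt
    generic = elem C , idG DS , λ _ → refl

    representative-injective : (x : Elt) → Injective _≡_ _≡_ (proj₁ x)
    representative-injective (w , ρ , w≡ρ) {i} {j} wi≡wj =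
      elem-inj C (app-injective ρ (trans (sym (w≡ρ i)) (trans wi≡wj (w≡ρ j))))

    image-supports : (x : Elt) → Supports DS (X DS C S) (tabulate (proj₁ x)) x
    image-supports (w , _) π fixes =
      id , S.P-id , λ i → sym (fixes (w i) (∈-tabulate⁺ i))

    X-nominal : IsNominal DS (X DS C S)
    X-nominal x = tabulate (proj₁ x) , image-supports x

    generic-act : (x : Elt) → act generic (proj₁ (proj₂ x)) ≈S x
    generic-act (w , ρ , w≡ρ) = id , S.P-id , w≡ρ

    generic-fixed : ∀ {σ} (σ∈S : S.P σ) →
      generic ≈S act generic (proj₁ (S.P-⊆ σ∈S))
    generic-fixed {σ} σ∈S = σ , σ∈S , λ i → sym (proj₂ (S.P-⊆ σ∈S) i)

    equivariant-determined : ∀ {B : GSet DS} (f : Equivariant DS (X DS C S) B)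
      (x : Elt) → GSet._≈_ B (fun f x) (GSet.act B (fun f generic) (proj₁ (proj₂ x)))
    equivariant-determined {B} f x@(_ , ρ , _) = begin
      fun f x                      ≈⟨ cong′ f (≈S-sym {act generic ρ} {x} (generic-act x)) ⟩
      fun f (act generic ρ)        ≈⟨ equiv f generic ρ ⟩
      GSet.act B (fun f generic) ρ ∎
      where open SetoidReasoning (GSet.setoid B)

  module _ {D : FinSet DS} (fungible : Fungible DS D) (T : Subgroup DS D) where
    open XCS DS D T

    isolating-conjugate : (y : Elt) (d : Fin (size D)) → ∃[ π ]
      ((∀ j → j ≢ d → app DS π (proj₁ y j) ≡ proj₁ y j) × ¬ (act y π ≈S y))
    isolating-conjugate y@(v , ρ , v≡ρ) d with fungible d
    ... | ι , ι-moves-d , ι-fixes-others = π , fixes , moves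
      where
      π : Gel DS
      π = conjugate ρ ι

      π-on-v : ∀ j → app DS π (v j) ≡ app DS ρ (app DS ι (elem D j))
      π-on-v j rewrite v≡ρ j = app-conjugate ρ ι (elem D j)

      fixes : ∀ j → j ≢ d → app DS π (v j) ≡ v j
      fixes j j≢d = trans (π-on-v j)
        (trans (cong (app DS ρ) (ι-fixes-others j j≢d)) (sym (v≡ρ j)))

      moves : ¬ (act y π ≈S y)
      moves (σ , _ , vd≡πvσd) with σ d ≟ d
      ... | yes σd≡d = ι-moves-d (app-injective ρ (begin
        app DS ρ (app DS ι (elem D d)) ≡⟨ π-on-v d ⟨
        app DS π (v d)                 ≡⟨ cong (app DS π ∘ v) σd≡d ⟨
        app DS π (v (σ d))             ≡⟨ vd≡πvσd d ⟨
        v d                            ≡⟨ v≡ρ d ⟩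
        app DS ρ (elem D d)            ∎))
        where open ≡-Reasoning
      ... | no σd≢d = σd≢d (sym (representative-injective D T y
                              (trans (vd≡πvσd d) (fixes (σ d) σd≢d))))

    image⊆support-of-image : (y : Elt) {L : FinSubset DS} →
      Supports DS (X DS D T) L y → L ⊆ tabulate (proj₁ y) → ∀ d → proj₁ y d ∈ L
    image⊆support-of-image y {L} sup L⊆v d with hit-or-avoid (proj₁ y) d L L⊆v
    ... | inj₁ hit   = hit
    ... | inj₂ avoid with isolating-conjugate y d
    ...   | π , fixes , moves = ⊥-elim (moves (sup π fixes-L))
      where
      fixes-L : ∀ c → c ∈ L → app DS π c ≡ c
      fixes-L c c∈L with avoid c∈L
      ... | i , i≢d , refl = fixes i i≢d

    image⊆support : AdmitsLeastSupports DS → (y : Elt) {L : FinSubset DS} →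
      Supports DS (X DS D T) L y → ∀ d → proj₁ y d ∈ L
    image⊆support least-supports y {L} sup d
      with least-supports (X DS D T) (X-nominal D T) y
    ... | _ , supM , least = least L sup (proj₁ y d) (image⊆support-of-image y supM
            (λ {m} → least (tabulate (proj₁ y)) (image-supports D T y) m) d)

  module Correspondence (least-supports : AdmitsLeastSupports DS)
    (C D : FinSet DS) (D-fungible : Fungible DS D)
    (S : Subgroup DS C) (T : Subgroup DS D) where
    open Maps DS C D S T
    private
      XC YD : GSet DS
      XC = X DS C S
      YD = X DS D T
      module Y = GSet YD

      EquivariantX→Y : Setoid 0ℓ 0ℓ
      EquivariantX→Y = EquivariantSetoid DS XC YD
      module EquivariantX→Y = Setoid EquivariantX→Y

    module _ (f : Equivariant DS XC YD) where
      private
        y : Y.Carrier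
        y = fun f (generic C S)

        v : Fin (size D) → 𝔻
        v = proj₁ y

      generic-image-in-C : ∀ d → ∃[ j ] v d ≡ elem C j
      generic-image-in-C d = ∈-tabulate⁻ (image⊆support D-fungible T least-supports
        y (equivariant-supports f (image-supports C S (generic C S))) d)

      generic-image-fixed : ∀ {σ} (σ∈S : S.P σ) →
        y Y.≈ Y.act y (proj₁ (S.P-⊆ σ∈S))
      generic-image-fixed σ∈S = begin
        y                                   ≈⟨ cong′ f (generic-fixed C S σ∈S) ⟩
        fun f (GSet.act XC (generic C S) π) ≈⟨ equiv f (generic C S) π ⟩
        Y.act y π                           ∎
        where
        π : Gel DS
        π = proj₁ (S.P-⊆ σ∈S)
        open SetoidReasoning Y.setoid

      embedding : Fin (size D) → Fin (size C)
      embedding d = proj₁ (generic-image-in-C d)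

      elem-embedding : ∀ d → elem C (embedding d) ≡ v d
      elem-embedding d = sym (proj₂ (generic-image-in-C d))

      embedding-good : Good embedding
      embedding-good = injective , restriction , commutes
        where
        injective : Injective _≡_ _≡_ embedding
        injective {i} {j} e = representative-injective D T y
          (trans (sym (elem-embedding i)) (trans (cong (elem C) e) (elem-embedding j)))

        restriction : IsRestriction DS D (elem C ∘ embedding)
        restriction =
          proj₁ (proj₂ y) , λ d → trans (elem-embedding d) (proj₂ (proj₂ y) d)

        commutes : ∀ σ → S.P σ → ∃[ τ ] (T.P τ × (σ ∘ embedding ≗ embedding ∘ τ))
        commutes σ σ∈S with generic-image-fixed σ∈S
        ... | τ , τ∈T , πv≡vτ = τ , τ∈T , λ d → elem-inj C (begin
          elem C (σ (embedding d))        ≡⟨ proj₂ (S.P-⊆ σ∈S) (embedding d) ⟩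
          app DS π (elem C (embedding d)) ≡⟨ cong (app DS π) (elem-embedding d) ⟩
          app DS π (v d)                  ≡⟨ πv≡vτ d ⟩
          v (τ d)                         ≡⟨ elem-embedding (τ d) ⟨
          elem C (embedding (τ d))        ∎)
          where
          π : Gel DS
          π = proj₁ (S.P-⊆ σ∈S)
          open ≡-Reasoning

    mapOf : Equivariant DS XC YD → Elt
    mapOf f = embedding f , embedding-good f

    equivariantOf : Elt → Equivariant DS XC YD
    equivariantOf (u , _ , (ρ′ , u≡ρ′) , commutes) = record
      { fun = λ { (w , ρ , w≡ρ) →
          w ∘ u , _∘G_ DS ρ ρ′ , λ d → trans (w≡ρ (u d)) (cong (app DS ρ) (u≡ρ′ d)) }
      ; cong′ = λ { {w , _} (σ , σ∈S , w′≡wσ) →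
          let (τ , τ∈T , σu≗uτ) = commutes σ σ∈S in
          τ , τ∈T , λ d → trans (w′≡wσ (u d)) (cong w (σu≗uτ d)) }
      ; equiv = λ _ _ → id , T.P-id , λ _ → refl
      }

    mapOf-cong : ∀ {f g} → f EquivariantX→Y.≈ g → mapOf f ≈T mapOf g
    mapOf-cong {f} {g} f≈g with f≈g (generic C S)
    ... | τ , τ∈T , vg≡vfτ = τ , τ∈T , λ d → elem-inj C
      (trans (elem-embedding g d) (trans (vg≡vfτ d) (sym (elem-embedding f (τ d)))))

    equivariantOf-cong : ∀ {u u′} → u ≈T u′ →
      equivariantOf u EquivariantX→Y.≈ equivariantOf u′
    equivariantOf-cong (τ , τ∈T , u′≗uτ) (w , _) = τ , τ∈T , λ d → cong w (u′≗uτ d)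

    mapOf-equivariantOf : ∀ u → mapOf (equivariantOf u) ≈T u
    mapOf-equivariantOf u =
      id , T.P-id , λ d → elem-inj C (sym (elem-embedding (equivariantOf u) d))

    equivariantOf-mapOf : ∀ f → equivariantOf (mapOf f) EquivariantX→Y.≈ f
    equivariantOf-mapOf f x@(w , ρ , w≡ρ) = begin
      fun (equivariantOf (mapOf f)) x ≈⟨ id , T.P-id , w∘embedding≡ρv ⟩
      Y.act (fun f (generic C S)) ρ   ≈⟨ equivariant-determined C S f x ⟨
      fun f x                         ∎
      where
      w∘embedding≡ρv : ∀ d → app DS ρ (proj₁ (fun f (generic C S)) d) ≡ w (embedding f d)
      w∘embedding≡ρv d =
        sym (trans (w≡ρ (embedding f d)) (cong (app DS ρ) (elem-embedding f d)))
      open SetoidReasoning Y.setoid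

    correspondence : Inverse EquivariantX→Y setoid
    correspondence = record
      { to        = mapOf
      ; from      = equivariantOf
      ; to-cong   = λ {f} {g} → mapOf-cong {f} {g}
      ; from-cong = λ {u} {u′} → equivariantOf-cong {u} {u′}
      ; inverse   = (λ {u} {f} → inverseˡ {u} {f}) , (λ {f} {u} → inverseʳ {f} {u})
      }
      where
      inverseˡ : Inverseˡ EquivariantX→Y._≈_ _≈T_ mapOf equivariantOf
      inverseˡ {u} {f} = strictlyInverseˡ⇒inverseˡ EquivariantX→Y setoid
        {f = mapOf} {f⁻¹ = equivariantOf}
        (λ {f} {g} → mapOf-cong {f} {g}) mapOf-equivariantOf {u} {f}

      inverseʳ : Inverseʳ EquivariantX→Y._≈_ _≈T_ mapOf equivariantOf
      inverseʳ {f} {u} = strictlyInverseʳ⇒inverseʳ EquivariantX→Y setoid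
        {f⁻¹ = equivariantOf} {f = mapOf}
        (λ {u} {u′} → equivariantOf-cong {u} {u′}) equivariantOf-mapOf {f} {u}

proposition9p16 : (DS : DataSymmetry) → AdmitsLeastSupports DS →
    (C D : FinSet DS) → Fungible DS C → Fungible DS D →
    (S : Subgroup DS C) (T : Subgroup DS D) →
    Inverse (EquivariantSetoid DS (X DS C S) (X DS D T))
    (Maps.setoid DS C D S T)
proposition9p16 DS least-supports C D _ D-fungible S T =
  Correspondence.correspondence DS least-supports C D D-fungible S T
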